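{- Let $G$ be a finite graph. Suppose that for all entanglements $\varepsilon_1,\varepsilon_2$ in $G$ (possibly $\varepsilon_1=\varepsilon_2$) and any two crossing separations $s_1\in\varepsilon_1$, $s_2\in\varepsilon_2$, there exist an index $i\in\{1,2\}$ and a separation $c\in\varepsilon_i$ with $x(c)<x(s_i)$. Then the set of friendly separations of $G$ is nested.
   Context: A separation of a graph $G$ is a set $\{A,B\}$ with $A\cup B=V(G)$ such that $G$ has no edge between $A\setminus B$ and $B\setminus A$; its order is $|A\cap B|$; it is proper if $A\setminus B,B\setminus A\neq\emptyset$. Two separations $\{A,B\},\{C,D\}$ are nested if, after possibly renaming sides, $A\subseteq C$ and $B\supseteq D$; otherwise they cross. A set of separations is nested if its elements are pairwise nested. For crossing $\{A,B\},\{C,D\}$ the four corners are $\{A\cap C,B\cup D\}$, $\{A\cap D,B\cup C\}$, $\{B\cap D,A\cup C\}$, $\{B\cap C,A\cup D\}$; the first two lie on the same side of $\{A,B\}$, as do the last two. An entanglement in $G$ is a non-empty set $\varepsilon$ of proper separations such that: if $\{A,B\}\in\varepsilon$ is crossed by a separation of $G$ so that two corners lying on the same side of $\{A,B\}$ have order at most $|A\cap B|$, then at least one of them has order equal to $|A\cap B|$ and lies in $\varepsilon$. For a separation $s$, the crossing number $x(s)$ is the number of separations lying in (at least one) entanglement in $G$ that are crossed by $s$. A separation $s$ is friendly if it lies in some entanglement $\varepsilon$ such that no other separation in $\varepsilon$ has smaller crossing number than $s$. -}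

module Defs where

open import Level using (0ℓ)
open import Data.Nat using (ℕ; _≤_; _<_)
open import Data.Fin using (Fin)
open import Data.Fin.Subset using (Subset; _∈_; _∉_; _⊆_; _∩_; _∪_; ∣_∣)
open import Data.Product using (Σ; ∃; _×_; _,_; proj₁; proj₂)
open import Data.Sum using (_⊎_)
open import Data.List using (List; length)
open import Data.List.Relation.Unary.Any using (Any)
open import Data.List.Relation.Unary.AllPairs using (AllPairs)
open import Relation.Nullary using (¬_)
open import Relation.Binary.PropositionalEquality using (_≡_)
open import Function.Bundles using (_⇔_)

record Graph : Set₁ where
  field
    n     : ℕ
    E     : Fin n → Fin n → Set
    sym   : ∀ {u v} → E u v → E v u
    irref : ∀ {u} → ¬ E u u

module _ (G : Graph) where
  open Graph G

  -- A separation {A,B} is represented by an ordered pair (A , B);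
  -- (A , B) and (B , A) represent the same separation (see SepEq).
  Sep : Set
  Sep = Subset n × Subset n

  swap : Sep → Sep
  swap (A , B) = (B , A)

  SepEq : Sep → Sep → Set
  SepEq s t = s ≡ t ⊎ s ≡ swap t

  IsSep : Sep → Set
  IsSep (A , B) =
    (∀ v → v ∈ A ⊎ v ∈ B) ×
    (∀ u v → u ∈ A → u ∉ B → v ∈ B → v ∉ A → ¬ E u v)

  order : Sep → ℕ
  order (A , B) = ∣ A ∩ B ∣

  Proper : Sep → Set
  Proper (A , B) = (∃ λ v → v ∈ A × v ∉ B) × (∃ λ v → v ∈ B × v ∉ A)

  -- nested, after possibly renaming the sides of either separation
  Nested : Sep → Sep → Set
  Nested (A , B) (C , D) =
    (A ⊆ C × D ⊆ B) ⊎ (A ⊆ D × C ⊆ B) ⊎ (B ⊆ C × D ⊆ A) ⊎ (B ⊆ D × C ⊆ A)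

  Crosses : Sep → Sep → Set
  Crosses s t = ¬ Nested s t

  -- Sets of separations: a predicate on ordered pairs; the unordered
  -- separation {A,B} belongs to ε if (A,B) or (B,A) satisfies ε.
  SepSet : Set₁
  SepSet = Sep → Set

  Mem : SepSet → Sep → Set
  Mem ε s = ε s ⊎ ε (swap s)

  -- the corner condition for two corners c₁ c₂ on the same side of a
  -- separation of order k
  CornerCond : SepSet → ℕ → Sep → Sep → Set
  CornerCond ε k c₁ c₂ =
    order c₁ ≤ k → order c₂ ≤ k →
    (order c₁ ≡ k × Mem ε c₁) ⊎ (order c₂ ≡ k × Mem ε c₂)

  IsEntanglement : SepSet → Set
  IsEntanglement ε =
    (∃ λ s → Mem ε s) ×
    (∀ s → Mem ε s → IsSep s × Proper s) ×
    (∀ A B → Mem ε (A , B) → ∀ C D → IsSep (C , D) → Crosses (A , B) (C , D) →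
       CornerCond ε (order (A , B)) (A ∩ C , B ∪ D) (A ∩ D , B ∪ C) ×
       CornerCond ε (order (A , B)) (B ∩ D , A ∪ C) (B ∩ C , A ∪ D))

  InSomeEntanglement : Sep → Set₁
  InSomeEntanglement s = Σ SepSet λ ε → IsEntanglement ε × Mem ε s

  -- CrossNum s k : the crossing number x(s) equals k, i.e. the number of
  -- (unordered) separations lying in some entanglement and crossed by s is k.
  CrossNum : Sep → ℕ → Set₁
  CrossNum s k = Σ (List Sep) λ L →
    (∀ t → (InSomeEntanglement t × Crosses s t) ⇔ Any (SepEq t) L) ×
    AllPairs (λ a b → ¬ SepEq a b) L ×
    length L ≡ k

  SmallerX : Sep → Sep → Set₁
  SmallerX c s = Σ ℕ λ k → Σ ℕ λ l → CrossNum c k × CrossNum s l × k < l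

  Friendly : Sep → Set₁
  Friendly s = Σ SepSet λ ε → IsEntanglement ε × Mem ε s ×
    (∀ t → Mem ε t → ¬ SepEq t s → ∀ k l → CrossNum t k → CrossNum s l → ¬ k < l)

module Submission where

-- If two friendly separations s ∈ ε₁ and t ∈ ε₂ crossed, the hypothesis would
-- give a member of ε₁ (or ε₂) with strictly smaller crossing number than s (or
-- t).  That member cannot be s itself, because the crossing number depends only
-- on the unordered separation; so it contradicts the friendliness of s (or t).
-- Since nestedness of two separations is decidable, not crossing means nested.

open import Defs
open import Level using (0ℓ)
open import Data.Product using (Σ; _×_; _,_)
open import Data.Sum using (_⊎_; inj₁; inj₂; [_,_])
open import Data.Empty using (⊥-elim)
open import Data.Nat using (_≤_; _<_; z≤n; s≤s)
open import Data.Nat.Properties using (≤-antisym; <-irrefl)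
open import Data.List using ([]; _∷_; length)
open import Data.List.Properties using (length-removeAt′)
open import Data.List.Relation.Unary.Any using (Any; here; there)
open import Data.List.Relation.Unary.AllPairs using (_∷_)
open import Data.Fin.Subset.Properties using (_⊆?_)
open import Relation.Nullary using (¬_; Dec)
open import Relation.Nullary.Decidable using (_×-dec_; _⊎-dec_; decidable-stable)
open import Relation.Binary.Bundles using (Setoid)
open import Relation.Binary.PropositionalEquality using (_≡_; refl; sym; subst)
open import Function.Bundles using (Equivalence)
import Data.List.Membership.Setoid as SetoidMembership
import Data.List.Membership.Setoid.Properties as SetoidMembershipProperties
import Data.List.Relation.Binary.Subset.Setoid as SetoidSubset
import Data.List.Relation.Unary.Unique.Setoid as SetoidUnique

module UniqueLength {c ℓ} (S : Setoid c ℓ) where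
  open Setoid S using (_≈_) renaming (refl to ≈-refl; sym to ≈-sym; trans to ≈-trans)
  open SetoidMembership S using (_∈_; _─_)
  open SetoidMembershipProperties using (∈-resp-≈; All[≉]⇒∉)
  open SetoidSubset S using (_⊆_)
  open SetoidUnique S using (Unique)

  ∈-─ : ∀ {x y ys} (x∈ys : x ∈ ys) → y ∈ ys → y ∈ ys ─ x∈ys ⊎ y ≈ x
  ∈-─ (here x≈z)   (here y≈z)   = inj₂ (≈-trans y≈z (≈-sym x≈z))
  ∈-─ (here _)     (there y∈ys) = inj₁ y∈ys
  ∈-─ (there _)    (here y≈z)   = inj₁ (here y≈z)
  ∈-─ (there x∈ys) (there y∈ys) with ∈-─ x∈ys y∈ys
  ... | inj₁ y∈ys─x = inj₁ (there y∈ys─x)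
  ... | inj₂ y≈x    = inj₂ y≈x

  Unique-⊆⇒|xs|≤|ys| : ∀ {xs ys} → Unique xs → xs ⊆ ys → length xs ≤ length ys
  Unique-⊆⇒|xs|≤|ys| {[]} _ _ = z≤n
  Unique-⊆⇒|xs|≤|ys| {x ∷ xs} {ys} (x≉xs ∷ uniq) x∷xs⊆ys =
    subst (length (x ∷ xs) ≤_) (sym (length-removeAt′ ys _))
      (s≤s (Unique-⊆⇒|xs|≤|ys| uniq xs⊆ys─x))
    where
    x∈ys : x ∈ ys
    x∈ys = x∷xs⊆ys (here ≈-refl)

    xs⊆ys─x : xs ⊆ ys ─ x∈ys
    xs⊆ys─x y∈xs with ∈-─ x∈ys (x∷xs⊆ys (there y∈xs))
    ... | inj₁ y∈ys─x = y∈ys─x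
    ... | inj₂ y≈x    = ⊥-elim (All[≉]⇒∉ S x≉xs (∈-resp-≈ S y≈x y∈xs))

module _ (G : Graph) where

  SepEq-setoid : Setoid 0ℓ 0ℓ
  SepEq-setoid = record
    { Carrier       = Sep G
    ; _≈_           = SepEq G
    ; isEquivalence = record { refl = inj₁ refl ; sym = SepEq-sym ; trans = SepEq-trans }
    }
    where
    SepEq-sym : ∀ {s t} → SepEq G s t → SepEq G t s
    SepEq-sym (inj₁ refl) = inj₁ refl
    SepEq-sym (inj₂ refl) = inj₂ refl

    SepEq-trans : ∀ {s t u} → SepEq G s t → SepEq G t u → SepEq G s u
    SepEq-trans (inj₁ refl) t≈u         = t≈u
    SepEq-trans (inj₂ refl) (inj₁ refl) = inj₂ refl
    SepEq-trans (inj₂ refl) (inj₂ refl) = inj₁ refl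

  open Setoid SepEq-setoid using () renaming (sym to SepEq-sym)
  open UniqueLength SepEq-setoid using (Unique-⊆⇒|xs|≤|ys|)

  Nested-swapˡ : ∀ s t → Nested G (swap G s) t → Nested G s t
  Nested-swapˡ _ _ (inj₁ n)               = inj₂ (inj₂ (inj₁ n))
  Nested-swapˡ _ _ (inj₂ (inj₁ n))        = inj₂ (inj₂ (inj₂ n))
  Nested-swapˡ _ _ (inj₂ (inj₂ (inj₁ n))) = inj₁ n
  Nested-swapˡ _ _ (inj₂ (inj₂ (inj₂ n))) = inj₂ (inj₁ n)

  Nested-respˡ : ∀ {s s′} t → SepEq G s s′ → Nested G s′ t → Nested G s t
  Nested-respˡ     t (inj₁ refl) n = n
  Nested-respˡ {s} t (inj₂ refl) n = Nested-swapˡ s t n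

  CrossNum-mono : ∀ {s s′ k l} → SepEq G s s′ → CrossNum G s k → CrossNum G s′ l → k ≤ l
  CrossNum-mono s≈s′ (L , L-spec , L-unique , refl) (L′ , L′-spec , _ , refl) =
    Unique-⊆⇒|xs|≤|ys| L-unique L⊆L′
    where
    L⊆L′ : ∀ {t} → Any (SepEq G t) L → Any (SepEq G t) L′
    L⊆L′ {t} t∈L with Equivalence.from (L-spec t) t∈L
    ... | (t-entangled , s⋈t) =
      Equivalence.to (L′-spec t) (t-entangled , λ s′∥t → s⋈t (Nested-respˡ t s≈s′ s′∥t))

  CrossNum-functional : ∀ {s s′ k l} → SepEq G s s′ → CrossNum G s k → CrossNum G s′ l → k ≡ l
  CrossNum-functional s≈s′ xs xs′ =
    ≤-antisym (CrossNum-mono s≈s′ xs xs′) (CrossNum-mono (SepEq-sym s≈s′) xs′ xs)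

  nested? : ∀ s t → Dec (Nested G s t)
  nested? (A , B) (C , D) =
    ((A ⊆? C) ×-dec (D ⊆? B)) ⊎-dec ((A ⊆? D) ×-dec (C ⊆? B)) ⊎-dec
    ((B ⊆? C) ×-dec (D ⊆? A)) ⊎-dec ((B ⊆? D) ×-dec (C ⊆? A))

  minimal⇒¬SmallerX : ∀ {ε s c} →
    (∀ t → Mem G ε t → ¬ SepEq G t s → ∀ k l → CrossNum G t k → CrossNum G s l → ¬ k < l) →
    Mem G ε c → ¬ SmallerX G c s
  minimal⇒¬SmallerX s-minimal c∈ε (k , l , xc , xs , k<l) =
    s-minimal _ c∈ε (λ c≈s → <-irrefl (CrossNum-functional c≈s xc xs) k<l) k l xc xs k<l

lemma3p1 : (G : Graph) →
    (∀ (ε₁ ε₂ : SepSet G) → IsEntanglement G ε₁ → IsEntanglement G ε₂ →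
       ∀ s₁ s₂ → Mem G ε₁ s₁ → Mem G ε₂ s₂ → Crosses G s₁ s₂ →
       (Σ (Sep G) λ c → Mem G ε₁ c × SmallerX G c s₁) ⊎
       (Σ (Sep G) λ c → Mem G ε₂ c × SmallerX G c s₂)) →
    ∀ s t → Friendly G s → Friendly G t → Nested G s t
lemma3p1 G H s t (ε₁ , ε₁-ent , s∈ε₁ , s-minimal) (ε₂ , ε₂-ent , t∈ε₂ , t-minimal) =
  decidable-stable (nested? G s t) λ s⋈t →
    [ (λ (c , c∈ε₁ , c<s) → minimal⇒¬SmallerX G s-minimal c∈ε₁ c<s)
    , (λ (c , c∈ε₂ , c<t) → minimal⇒¬SmallerX G t-minimal c∈ε₂ c<t)
    ] (H ε₁ ε₂ ε₁-ent ε₂-ent s t s∈ε₁ t∈ε₂ s⋈t)
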